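{- For every integer $n>0$, $$\delta(n+1)=\delta(n)+\bigl(\lfloor\log_2(n)\rfloor-2\,\omega(n)+2\bigr),$$ with $\delta(1)=0$, where $\delta(m)$ is the number of $D$-nodes in the divide-and-conquer tree with $m$ leaves and $\omega(n)$ is the number of $1$s in the binary expansion of $n$.
   Context: A full binary tree is a rooted tree in which every node has $0$ or $2$ children. An internal node is a $D$-node if its two children have different numbers of descendant leaves. A divide-and-conquer tree is a full binary tree in which, at every internal node, the numbers of leaves of the left and right subtrees differ by at most $1$; it is unique up to isomorphism for each number of leaves. -}

module Defs where

open import Data.Nat using (ℕ; zero; suc; _+_)
open import Data.Bool using (Bool; true; false; if_then_else_)
open import Data.Product using (_×_)
open import Relation.Binary.PropositionalEquality using (_≡_)

data FBTree : Set where
  leaf : FBTree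
  node : FBTree → FBTree → FBTree

leaves : FBTree → ℕ
leaves leaf = 1
leaves (node l r) = leaves l + leaves r

DiffAtMostOne : ℕ → ℕ → Set
DiffAtMostOne a b = (a ≡ b) Data.Sum.⊎ ((suc a ≡ b) Data.Sum.⊎ (a ≡ suc b))
  where import Data.Sum

data IsDC : FBTree → Set where
  leafDC : IsDC leaf
  nodeDC : ∀ {l r} → DiffAtMostOne (leaves l) (leaves r) → IsDC l → IsDC r → IsDC (node l r)

dNodes : FBTree → ℕ
dNodes leaf = 0
dNodes (node l r) =
  (if leaves l Data.Nat.≡ᵇ leaves r then 0 else 1) + dNodes l + dNodes r
  where import Data.Nat

onesFuel : ℕ → ℕ → ℕ
onesFuel zero m = 0
onesFuel (suc f) m = m Data.Nat.% 2 + onesFuel f (Data.Nat.⌊ m /2⌋)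
  where import Data.Nat

-- ω(n): number of 1s in the binary expansion of n (n has at most n bits)
ω : ℕ → ℕ
ω n = onesFuel n n

{-# OPTIONS --safe #-}
module Submission where

-- A divide-and-conquer tree with m ≥ 2 leaves splits at the root into such trees with
-- ⌊m/2⌋ and ⌈m/2⌉ leaves, and its root is a D-node exactly when m is odd; by strong
-- induction on m, all divide-and-conquer trees with m leaves have the same number δ(m)
-- of D-nodes. Since ⌊(m+1)/2⌋ = ⌈m/2⌉ and ⌈(m+1)/2⌉ = ⌊m/2⌋ + 1, the trees with m and
-- m + 1 leaves share the half ⌈m/2⌉, so δ(m+1) − δ(m) is expressed through the same
-- difference at h = ⌊m/2⌋. Together with ω(m) = (m mod 2) + ω(h) and
-- ⌊log₂ m⌋ = 1 + ⌊log₂ h⌋ this gives the recurrence by induction.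

open import Defs
open import Data.Nat using (ℕ; suc)
open import Data.Nat.Logarithm using (⌊log₂_⌋)
open import Data.Nat.Induction using (Acc; acc; <-wellFounded)
open import Data.Product using (_×_; _,_)
open import Relation.Binary.PropositionalEquality
  using (_≡_; _≢_; refl; sym; trans; cong; cong₂; subst; module ≡-Reasoning)

module DNodeCount where

  open import Data.Nat using (zero; _+_; _*_; _≤_; _<_; z≤n; s≤s; s≤s⁻¹; ⌊_/2⌋; ⌈_/2⌉; _∸_; _%_; _≡ᵇ_)
  open import Data.Nat.Properties
    using (≤-refl; ≤-trans; +-comm; +-suc; +-mono-≤; m≤m+n; m∸n+n≡m; ⌊n/2⌋<n; ⌈n/2⌉<n
          ; n≡⌊n+n/2⌋; n≡⌈n+n/2⌉; +-commutativeSemigroup)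
  open import Data.Nat.Logarithm using (⌊log₂⌊n/2⌋⌋≡⌊log₂n⌋∸1; ⌊log₂⌋-mono-≤)
  open import Data.Nat.Tactic.RingSolver using (solve)
  open import Algebra.Properties.CommutativeSemigroup +-commutativeSemigroup using (xy∙z≈xz∙y)
  open import Data.Bool using (if_then_else_)
  open import Data.List using (_∷_; [])
  open import Data.Sum using (_⊎_; inj₁; inj₂)
  open import Data.Empty using (⊥-elim)
  open ≡-Reasoning

  [1+n]%2+n%2≡1 : ∀ n → suc n % 2 + n % 2 ≡ 1
  [1+n]%2+n%2≡1 zero = refl
  [1+n]%2+n%2≡1 (suc zero) = refl
  [1+n]%2+n%2≡1 (suc (suc n)) = [1+n]%2+n%2≡1 n

  diffAtMostOne⇒halves : ∀ {a b} → DiffAtMostOne a b →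
    (a ≡ ⌊ a + b /2⌋ × b ≡ ⌈ a + b /2⌉) ⊎ (a ≡ ⌈ a + b /2⌉ × b ≡ ⌊ a + b /2⌋)
  diffAtMostOne⇒halves {a} (inj₁ refl) = inj₁ (n≡⌊n+n/2⌋ a , n≡⌈n+n/2⌉ a)
  diffAtMostOne⇒halves {a} (inj₂ (inj₁ refl)) =
    inj₁ ( trans (n≡⌈n+n/2⌉ a) (cong ⌊_/2⌋ (sym (+-suc a a)))
         , trans (cong suc (n≡⌊n+n/2⌋ a)) (cong ⌈_/2⌉ (sym (+-suc a a))))
  diffAtMostOne⇒halves {b = b} (inj₂ (inj₂ refl)) = inj₂ (cong suc (n≡⌊n+n/2⌋ b) , n≡⌈n+n/2⌉ b)

  isDNode : ℕ → ℕ → ℕ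
  isDNode a b = if a ≡ᵇ b then 0 else 1

  isDNode-comm : ∀ a b → isDNode a b ≡ isDNode b a
  isDNode-comm zero zero = refl
  isDNode-comm zero (suc b) = refl
  isDNode-comm (suc a) zero = refl
  isDNode-comm (suc a) (suc b) = isDNode-comm a b

  isDNode-halves : ∀ n → isDNode ⌊ n /2⌋ ⌈ n /2⌉ ≡ n % 2
  isDNode-halves zero = refl
  isDNode-halves (suc zero) = refl
  isDNode-halves (suc (suc n)) = isDNode-halves n

  isDNode-balanced : ∀ {a b} → DiffAtMostOne a b → isDNode a b ≡ (a + b) % 2
  isDNode-balanced {a} {b} d with diffAtMostOne⇒halves d
  ... | inj₁ (ea , eb) = trans (cong₂ isDNode ea eb) (isDNode-halves (a + b))
  ... | inj₂ (ea , eb) =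
    trans (cong₂ isDNode ea eb) (trans (isDNode-comm ⌈ a + b /2⌉ ⌊ a + b /2⌋) (isDNode-halves (a + b)))

  1≤leaves : ∀ t → 1 ≤ leaves t
  1≤leaves leaf = s≤s z≤n
  1≤leaves (node l r) = ≤-trans (1≤leaves l) (m≤m+n (leaves l) (leaves r))

  leaves≢0 : ∀ t → leaves t ≢ 0
  leaves≢0 t e with subst (1 ≤_) e (1≤leaves t)
  ... | ()

  leaves≡1⇒dNodes≡0 : ∀ t → leaves t ≡ 1 → dNodes t ≡ 0
  leaves≡1⇒dNodes≡0 leaf _ = refl
  leaves≡1⇒dNodes≡0 (node l r) e with subst (2 ≤_) e (+-mono-≤ (1≤leaves l) (1≤leaves r))
  ... | s≤s ()

  data Halves (m : ℕ) (t : FBTree) : Set where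
    halves : ∀ {l r} → IsDC l → IsDC r → leaves l ≡ ⌊ m /2⌋ → leaves r ≡ ⌈ m /2⌉ →
             dNodes t ≡ m % 2 + dNodes l + dNodes r → Halves m t

  dNodes-balanced-node : ∀ l r → DiffAtMostOne (leaves l) (leaves r) →
    dNodes (node l r) ≡ (leaves l + leaves r) % 2 + dNodes l + dNodes r
  dNodes-balanced-node l r d = cong (λ b → b + dNodes l + dNodes r) (isDNode-balanced d)

  node-halves : ∀ {l r} → IsDC (node l r) → Halves (leaves l + leaves r) (node l r)
  node-halves {l} {r} (nodeDC d dl dr) with diffAtMostOne⇒halves d
  ... | inj₁ (el , er) = halves dl dr el er (dNodes-balanced-node l r d)
  ... | inj₂ (el , er) =
    halves dr dl er el (trans (dNodes-balanced-node l r d) (xy∙z≈xz∙y _ (dNodes l) (dNodes r)))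

  dc-halves : ∀ {n t} → IsDC t → leaves t ≡ suc (suc n) → Halves (suc (suc n)) t
  dc-halves {t = leaf} _ ()
  dc-halves {t = node l r} d e = subst (λ m → Halves m (node l r)) e (node-halves d)

  dNodes-unique : ∀ {m} → Acc _<_ m → ∀ {s t} → IsDC s → IsDC t →
    leaves s ≡ m → leaves t ≡ m → dNodes s ≡ dNodes t
  dNodes-unique {zero} _ {s} _ _ es _ = ⊥-elim (leaves≢0 s es)
  dNodes-unique {suc zero} _ {s} {t} _ _ es et =
    trans (leaves≡1⇒dNodes≡0 s es) (sym (leaves≡1⇒dNodes≡0 t et))
  dNodes-unique {m@(suc (suc n))} (acc rs) ds dt es et with dc-halves ds es | dc-halves dt et
  ... | halves {ls} {hs} dls dhs els ehs eqs | halves {lt} {ht} dlt dht elt eht eqt =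
    trans eqs (trans (cong₂ (λ a b → m % 2 + a + b) lower upper) (sym eqt))
    where
    lower : dNodes ls ≡ dNodes lt
    lower = dNodes-unique (rs (⌊n/2⌋<n (suc n))) dls dlt els elt
    upper : dNodes hs ≡ dNodes ht
    upper = dNodes-unique (rs (⌈n/2⌉<n n)) dhs dht ehs eht

  onesFuel-0 : ∀ f → onesFuel f 0 ≡ 0
  onesFuel-0 zero = refl
  onesFuel-0 (suc f) = onesFuel-0 f

  onesFuel-irrelevant : ∀ {f g m} → m ≤ f → m ≤ g → onesFuel f m ≡ onesFuel g m
  onesFuel-irrelevant {f} {g} {zero} _ _ = trans (onesFuel-0 f) (sym (onesFuel-0 g))
  onesFuel-irrelevant {suc f} {suc g} {suc m} (s≤s m≤f) (s≤s m≤g) =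
    cong (suc m % 2 +_) (onesFuel-irrelevant (≤-trans half≤m m≤f) (≤-trans half≤m m≤g))
    where
    half≤m : ⌊ suc m /2⌋ ≤ m
    half≤m = s≤s⁻¹ (⌊n/2⌋<n m)

  ω-half : ∀ n → ω n ≡ n % 2 + ω ⌊ n /2⌋
  ω-half zero = refl
  ω-half (suc n) = cong (suc n % 2 +_) (onesFuel-irrelevant (s≤s⁻¹ (⌊n/2⌋<n n)) ≤-refl)

  ⌊log₂n⌋≡1+⌊log₂⌊n/2⌋⌋ : ∀ n → ⌊log₂ suc (suc n) ⌋ ≡ suc ⌊log₂ ⌊ suc (suc n) /2⌋ ⌋
  ⌊log₂n⌋≡1+⌊log₂⌊n/2⌋⌋ n = begin
    L                ≡⟨ sym (m∸n+n≡m (⌊log₂⌋-mono-≤ {2} {suc (suc n)} (s≤s (s≤s z≤n)))) ⟩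
    L ∸ 1 + 1        ≡⟨ +-comm _ 1 ⟩
    suc (L ∸ 1)      ≡⟨ cong suc (sym (⌊log₂⌊n/2⌋⌋≡⌊log₂n⌋∸1 (suc (suc n)))) ⟩
    suc ⌊log₂ ⌊ suc (suc n) /2⌋ ⌋ ∎
    where
    L = ⌊log₂ suc (suc n) ⌋

  recurrence-step : ∀ p q a b c w L → p + q ≡ 1 → c + 2 * w ≡ a + L + 2 →
    p + b + c + 2 * (q + w) ≡ q + a + b + suc L + 2
  recurrence-step p q a b c w L p+q≡1 ih = begin
    p + b + c + 2 * (q + w)       ≡⟨ solve (p ∷ q ∷ b ∷ c ∷ w ∷ []) ⟩
    (p + q) + q + b + (c + 2 * w) ≡⟨ cong₂ (λ x y → x + q + b + y) p+q≡1 ih ⟩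
    1 + q + b + (a + L + 2)       ≡⟨ solve (q ∷ a ∷ b ∷ L ∷ []) ⟩
    q + a + b + suc L + 2         ∎

  dNodes-recurrence : ∀ {m} → Acc _<_ m → ∀ {s t} → IsDC s → IsDC t →
    leaves s ≡ m → leaves t ≡ suc m → dNodes t + 2 * ω m ≡ dNodes s + ⌊log₂ m ⌋ + 2
  dNodes-recurrence {zero} _ {s} _ _ es _ = ⊥-elim (leaves≢0 s es)
  dNodes-recurrence {suc zero} _ {s} {t} ds dt es et =
    trans (cong (_+ 2) two-leaves) (sym (cong (λ d → d + 0 + 2) (leaves≡1⇒dNodes≡0 s es)))
    where
    two-leaves : dNodes t ≡ 0
    two-leaves = dNodes-unique (<-wellFounded 2) dt (nodeDC (inj₁ refl) leafDC leafDC) et refl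
  dNodes-recurrence {m@(suc (suc n))} (acc rs) {s} {t} ds dt es et
    with dc-halves ds es | dc-halves dt et
  ... | halves {ls} {hs} dls dhs els ehs eqs | halves {lt} {ht} dlt dht elt eht eqt = begin
    dNodes t + 2 * ω m
      ≡⟨ cong₂ (λ d w → d + 2 * w) eqt (ω-half m) ⟩
    suc m % 2 + dNodes lt + dNodes ht + 2 * (m % 2 + ω h)
      ≡⟨ cong (λ d → suc m % 2 + d + dNodes ht + 2 * (m % 2 + ω h)) shared-half ⟩
    suc m % 2 + dNodes hs + dNodes ht + 2 * (m % 2 + ω h)
      ≡⟨ recurrence-step (suc m % 2) (m % 2) (dNodes ls) (dNodes hs) (dNodes ht) (ω h) ⌊log₂ h ⌋
           ([1+n]%2+n%2≡1 m) (dNodes-recurrence (rs (⌊n/2⌋<n (suc n))) dls dht els eht) ⟩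
    m % 2 + dNodes ls + dNodes hs + suc ⌊log₂ h ⌋ + 2
      ≡⟨ cong₂ (λ d L → d + L + 2) (sym eqs) (sym (⌊log₂n⌋≡1+⌊log₂⌊n/2⌋⌋ n)) ⟩
    dNodes s + ⌊log₂ m ⌋ + 2 ∎
    where
    -- ⌊ suc m /2⌋ is ⌈ m /2⌉ and ⌈ suc m /2⌉ is suc h by definition, so the halves line up.
    h = ⌊ m /2⌋
    shared-half : dNodes lt ≡ dNodes hs
    shared-half = dNodes-unique (rs (⌈n/2⌉<n n)) dlt dhs elt ehs

open DNodeCount using (dNodes-unique; dNodes-recurrence)

open import Data.Integer using (ℤ; +_; _+_; _-_)
open import Data.Integer.Properties using (pos-+)
open import Data.Integer.Tactic.RingSolver using (solve)
open import Data.List using (_∷_; [])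
open ≡-Reasoning

x+w≡y+l+c⇒x≡y+[l-w+c] : ∀ {x y l w c : ℤ} → x + w ≡ y + l + c → x ≡ y + (l - w + c)
x+w≡y+l+c⇒x≡y+[l-w+c] {x} {y} {l} {w} {c} eq = begin
  x             ≡⟨ solve (x ∷ w ∷ []) ⟩
  x + w - w     ≡⟨ cong (_- w) eq ⟩
  y + l + c - w ≡⟨ solve (y ∷ l ∷ w ∷ c ∷ []) ⟩
  y + (l - w + c) ∎

ℕ-balance⇒ℤ-difference : ∀ {m n l w} → m Data.Nat.+ w ≡ n Data.Nat.+ l Data.Nat.+ 2 →
  + m ≡ + n + (+ l - + w + + 2)
ℕ-balance⇒ℤ-difference {m} {n} {l} {w} eq = x+w≡y+l+c⇒x≡y+[l-w+c] {y = + n} {+ l} {+ w} {+ 2} (begin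
  + m + + w                 ≡⟨ sym (pos-+ m w) ⟩
  + (m Data.Nat.+ w)        ≡⟨ cong +_ eq ⟩
  + (n Data.Nat.+ l Data.Nat.+ 2) ≡⟨ pos-+ (n Data.Nat.+ l) 2 ⟩
  + (n Data.Nat.+ l) + + 2  ≡⟨ cong (_+ + 2) (pos-+ n l) ⟩
  + n + + l + + 2           ∎)

theorem62 : ((t : FBTree) → IsDC t → leaves t ≡ 1 → dNodes t ≡ 0)
    × ((n : ℕ) → (s t : FBTree) → IsDC s → leaves s ≡ suc n → IsDC t → leaves t ≡ suc (suc n)
      → + dNodes t ≡ (+ dNodes s) + ((+ ⌊log₂ suc n ⌋) - (+ (2 Data.Nat.* ω (suc n))) + + 2))
theorem62 = one-leaf , recurrence
  where
  one-leaf : (t : FBTree) → IsDC t → leaves t ≡ 1 → dNodes t ≡ 0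
  one-leaf t d e = dNodes-unique (<-wellFounded 1) d leafDC e refl

  recurrence : (n : ℕ) → (s t : FBTree) → IsDC s → leaves s ≡ suc n → IsDC t → leaves t ≡ suc (suc n)
    → + dNodes t ≡ (+ dNodes s) + ((+ ⌊log₂ suc n ⌋) - (+ (2 Data.Nat.* ω (suc n))) + + 2)
  recurrence n s t ds es dt et =
    ℕ-balance⇒ℤ-difference (dNodes-recurrence (<-wellFounded (suc n)) ds dt es et)
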